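{- Let $U$ be a set and $\lesssim$ a quasiorder on $U$. For $x\in U$ put $[x)=\{y\mid x\lesssim y\}$ and $(x]=\{y\mid y\lesssim x\}$, and for $X\subseteq U$ put $X^{\blacktriangle}=\{x\mid [x)\cap X\neq\emptyset\}$, $X^{\blacktriangledown}=\{x\mid [x)\subseteq X\}$, $X^{\triangledown}=\{x\mid (x]\subseteq X\}$. Let $\mathit{RS}=\{(X^{\blacktriangledown},X^{\blacktriangle})\mid X\subseteq U\}$, ordered coordinatewise by inclusion. Then for all $(A,B),(C,D)\in\mathit{RS}$ the relative pseudocomplement of $(A,B)$ with respect to $(C,D)$ in $\langle\mathit{RS};\le\rangle$ exists and equals $$(A,B)\Rightarrow(C,D)=\big((A^c\cup C)^{\blacktriangledown}\cap (B^c\cup D)^{\triangledown\blacktriangledown},\ (B^c\cup D)^{\triangledown}\big),$$ where $Y^c=U\setminus Y$.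
   Context: Superscript operators are applied left to right, e.g. $Y^{\triangledown\blacktriangledown}=(Y^{\triangledown})^{\blacktriangledown}$. The relative pseudocomplement $a\Rightarrow b$ of $a$ with respect to $b$ in a lattice is the greatest element $c$ with $a\wedge c\le b$; in $\mathit{RS}$, $\wedge$ is coordinatewise intersection. -}

module Defs where

open import Level using (Level; suc)
open import Data.Product using (Σ; ∃; _×_; _,_)
open import Data.Sum using (_⊎_)
open import Relation.Nullary using (¬_)
open import Relation.Binary.Core using (Rel)
open import Relation.Binary.Definitions using (Reflexive; Transitive)
open import Relation.Unary using (Pred; _⊆_; _∩_; _∪_)

record IsQuasiorder {ℓ : Level} {U : Set ℓ} (_≲_ : Rel U ℓ) : Set ℓ where
  field
    refl  : Reflexive _≲_
    trans : Transitive _≲_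

module Approx {ℓ : Level} {U : Set ℓ} (_≲_ : Rel U ℓ) where

  up : U → Pred U ℓ
  up x y = x ≲ y

  down : U → Pred U ℓ
  down x y = y ≲ x

  _ᶜ : Pred U ℓ → Pred U ℓ
  (Y ᶜ) x = ¬ Y x

  _▲ : Pred U ℓ → Pred U ℓ
  (X ▲) x = ∃ λ y → x ≲ y × X y

  _▼ : Pred U ℓ → Pred U ℓ
  (X ▼) x = up x ⊆ X

  _▽ : Pred U ℓ → Pred U ℓ
  (X ▽) x = down x ⊆ X

  _≐_ : Pred U ℓ → Pred U ℓ → Set ℓ
  X ≐ Y = (X ⊆ Y) × (Y ⊆ X)

  Pair : Set (suc ℓ)
  Pair = Pred U ℓ × Pred U ℓ

  _≤ₚ_ : Pair → Pair → Set ℓ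
  (A , B) ≤ₚ (C , D) = (A ⊆ C) × (B ⊆ D)

  _∧ₚ_ : Pair → Pair → Pair
  (A , B) ∧ₚ (C , D) = (A ∩ C , B ∩ D)

  InRS : Pair → Set (suc ℓ)
  InRS (A , B) = Σ (Pred U ℓ) λ X → (A ≐ (X ▼)) × (B ≐ (X ▲))

  IsRelPseudocomplement : Pair → Pair → Pair → Set (suc ℓ)
  IsRelPseudocomplement a b c =
    InRS c × ((a ∧ₚ c) ≤ₚ b) × (∀ z → InRS z → (a ∧ₚ z) ≤ₚ b → z ≤ₚ c)

  rpcFormula : Pair → Pair → Pair
  rpcFormula (A , B) (C , D) =
    ((((A ᶜ) ∪ C) ▼) ∩ (((((B ᶜ) ∪ D) ▽) ▼)) , (((B ᶜ) ∪ D) ▽))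

{-# OPTIONS --safe #-}
module Submission where

-- For (A , B) ∈ RS the first component is an up-set, the second a down-set,
-- and A ⊆ B.  Classically A ∩ P ⊆ C iff P ⊆ Aᶜ ∪ C, and an up-set (down-set)
-- contained in S is contained in S▼ (S▽); this makes the formula an upper
-- bound of every admissible (P , Q).  It lies in RS because, writing
-- (C , D) = (Y▼ , Y▲) and (E , F) for the formula, it equals (Z▼ , Z▲) with
-- Z = E ∪ (F ∩ (Aᶜ ∪ Y)): Z ⊆ F, A ∩ Z ⊆ Y and Y ⊆ Z.

open import Defs
open import Level using (Level)
open import Function.Base using (id; flip; _∘_)
open import Relation.Binary.Core using (Rel)
open import Relation.Binary.Definitions using (_Respects_)
open import Axiom.ExcludedMiddle using (ExcludedMiddle)
open import Data.Product using (_,_; proj₁; proj₂)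
open import Data.Sum using (inj₁; inj₂; [_,_])
open import Data.Empty using (⊥-elim)
open import Relation.Nullary using (yes; no)
open import Relation.Unary using (Pred; _⊆_; _∩_; _∪_)

module _ {ℓ : Level} {U : Set ℓ} {_≲_ : Rel U ℓ} where
  open Approx _≲_

  private variable
    A B C D P Q S X : Pred U ℓ

  ∩ᶜ∪⊆ : A ∩ (A ᶜ ∪ C) ⊆ C
  ∩ᶜ∪⊆ (a , inj₁ ¬a) = ⊥-elim (¬a a)
  ∩ᶜ∪⊆ (a , inj₂ c)  = c

  ∩⊆⇒⊆ᶜ∪ : ExcludedMiddle ℓ → A ∩ X ⊆ C → X ⊆ A ᶜ ∪ C
  ∩⊆⇒⊆ᶜ∪ {A = A} em A∩X⊆C {x} x∈X with em {A x}
  ... | yes a = inj₂ (A∩X⊆C (a , x∈X))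
  ... | no ¬a = inj₁ ¬a

  ≐-respects : ∀ {ℓ′} {R : Rel U ℓ′} → X ≐ S → S Respects R → X Respects R
  ≐-respects (X⊆S , S⊆X) S-resp x∼y = S⊆X ∘ S-resp x∼y ∘ X⊆S

  ▼-mono : X ⊆ S → X ▼ ⊆ S ▼
  ▼-mono X⊆S x∈X▼ = X⊆S ∘ x∈X▼

  ▽-mono : X ⊆ S → X ▽ ⊆ S ▽
  ▽-mono X⊆S x∈X▽ = X⊆S ∘ x∈X▽

  ▲-mono : X ⊆ S → X ▲ ⊆ S ▲
  ▲-mono X⊆S (y , x≲y , y∈X) = y , x≲y , X⊆S y∈X

  ▼-∩ : (X ▼) ∩ (S ▼) ⊆ (X ∩ S) ▼
  ▼-∩ (x∈X▼ , x∈S▼) x≲y = x∈X▼ x≲y , x∈S▼ x≲y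

  ⊆▲▽ : X ⊆ (X ▲) ▽
  ⊆▲▽ {x = x} x∈X y≲x = x , y≲x , x∈X

  upClosed⇒⊆▼ : P Respects _≲_ → P ⊆ S → P ⊆ S ▼
  upClosed⇒⊆▼ P-up P⊆S x∈P x≲y = P⊆S (P-up x≲y x∈P)

  downClosed⇒⊆▽ : Q Respects flip _≲_ → Q ⊆ S → Q ⊆ S ▽
  downClosed⇒⊆▽ Q-down Q⊆S x∈Q y≲x = Q⊆S (Q-down y≲x x∈Q)

  downClosed⇒▲⊆ : Q Respects flip _≲_ → S ⊆ Q → S ▲ ⊆ Q
  downClosed⇒▲⊆ Q-down S⊆Q (y , x≲y , y∈S) = Q-down x≲y (S⊆Q y∈S)

  module _ (qo : IsQuasiorder _≲_) where
    open IsQuasiorder qo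

    ▼⊆ : X ▼ ⊆ X
    ▼⊆ x∈X▼ = x∈X▼ refl

    ▽⊆ : X ▽ ⊆ X
    ▽⊆ x∈X▽ = x∈X▽ refl

    ⊆▲ : X ⊆ X ▲
    ⊆▲ {x = x} x∈X = x , refl , x∈X

    ▼-upClosed : (X ▼) Respects _≲_
    ▼-upClosed x≲y x∈X▼ y≲z = x∈X▼ (trans x≲y y≲z)

    ▽-downClosed : (X ▽) Respects flip _≲_
    ▽-downClosed y≲x x∈X▽ z≲y = x∈X▽ (trans z≲y y≲x)

    ▲-downClosed : (X ▲) Respects flip _≲_
    ▲-downClosed y≲x (z , x≲z , z∈X) = z , trans y≲x x≲z , z∈X

    InRS⇒upClosed : InRS (A , B) → A Respects _≲_
    InRS⇒upClosed (_ , A≐X▼ , _) = ≐-respects A≐X▼ ▼-upClosed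

    InRS⇒downClosed : InRS (A , B) → B Respects flip _≲_
    InRS⇒downClosed (_ , _ , B≐X▲) = ≐-respects B≐X▲ ▲-downClosed

    InRS⇒⊆ : InRS (A , B) → A ⊆ B
    InRS⇒⊆ (_ , (A⊆X▼ , _) , (_ , X▲⊆B)) = X▲⊆B ∘ ⊆▲ ∘ ▼⊆ ∘ A⊆X▼

    rpcFormula-meet : ∀ a b → (a ∧ₚ rpcFormula a b) ≤ₚ b
    rpcFormula-meet (A , B) (C , D) =
        (λ (a , e) → ∩ᶜ∪⊆ {A = A} {C = C} (a , ▼⊆ (proj₁ e)))
      , (λ (b , f) → ∩ᶜ∪⊆ {A = B} {C = D} (b , ▽⊆ f))

    rpcFormula-greatest : ExcludedMiddle ℓ → ∀ a b z → InRS z → (a ∧ₚ z) ≤ₚ b →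
                          z ≤ₚ rpcFormula a b
    rpcFormula-greatest em (A , B) (C , D) (P , Q) PQ∈RS (A∩P⊆C , B∩Q⊆D) =
      (λ x∈P → P⊆▼ (∩⊆⇒⊆ᶜ∪ {A = A} em A∩P⊆C) x∈P , P⊆▼ (Q⊆F ∘ InRS⇒⊆ PQ∈RS) x∈P) , Q⊆F
      where
      P⊆▼ : P ⊆ S → P ⊆ S ▼
      P⊆▼ = upClosed⇒⊆▼ (InRS⇒upClosed PQ∈RS)

      Q⊆F : Q ⊆ (B ᶜ ∪ D) ▽
      Q⊆F = downClosed⇒⊆▽ (InRS⇒downClosed PQ∈RS) (∩⊆⇒⊆ᶜ∪ {A = B} em B∩Q⊆D)

    rpcFormula-InRS : ExcludedMiddle ℓ → ∀ a b → InRS a → InRS b → InRS (rpcFormula a b)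
    rpcFormula-InRS em (A , B) (C , D) AB∈RS (Y , (C⊆Y▼ , Y▼⊆C) , (D⊆Y▲ , Y▲⊆D)) =
      Z , (upClosed⇒⊆▼ E-upClosed inj₁ , Z▼⊆E) , (F⊆Z▲ , downClosed⇒▲⊆ ▽-downClosed Z⊆F)
      where
      F E Z : Pred U ℓ
      F = (B ᶜ ∪ D) ▽
      E = ((A ᶜ ∪ C) ▼) ∩ (F ▼)
      Z = E ∪ (F ∩ (A ᶜ ∪ Y))

      E-upClosed : E Respects _≲_
      E-upClosed x≲y (x∈E₁ , x∈E₂) = ▼-upClosed x≲y x∈E₁ , ▼-upClosed x≲y x∈E₂

      Z⊆F : Z ⊆ F
      Z⊆F = [ ▼⊆ ∘ proj₂ , proj₁ ]

      A∩Z⊆Y : A ∩ Z ⊆ Y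
      A∩Z⊆Y (a , inj₁ (x∈E₁ , _)) = ▼⊆ (C⊆Y▼ (∩ᶜ∪⊆ {A = A} {C = C} (a , ▼⊆ x∈E₁)))
      A∩Z⊆Y (a , inj₂ (_ , x∈Aᶜ∪Y)) = ∩ᶜ∪⊆ {A = A} {C = Y} (a , x∈Aᶜ∪Y)

      Y⊆Z : Y ⊆ Z
      Y⊆Z y = inj₂ (▽-mono {X = Y ▲} {S = B ᶜ ∪ D} (inj₂ ∘ Y▲⊆D) (⊆▲▽ y) , inj₂ y)

      Z▼⊆E : Z ▼ ⊆ E
      Z▼⊆E x∈Z▼ = upClosed⇒⊆▼ ▼-upClosed (∩⊆⇒⊆ᶜ∪ {A = A} em A∩Z▼⊆C) x∈Z▼ , ▼-mono Z⊆F x∈Z▼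
        where
        A∩Z▼⊆C : A ∩ (Z ▼) ⊆ C
        A∩Z▼⊆C (a , x∈Z▼) =
          Y▼⊆C (▼-mono A∩Z⊆Y (▼-∩ (upClosed⇒⊆▼ (InRS⇒upClosed AB∈RS) id a , x∈Z▼)))

      F⊆Z▲ : F ⊆ Z ▲
      F⊆Z▲ {x} x∈F with em {A x}
      ... | no ¬a = ⊆▲ {X = Z} (inj₂ (x∈F , inj₁ ¬a))
      ... | yes a = ▲-mono Y⊆Z (D⊆Y▲ (∩ᶜ∪⊆ {A = B} {C = D} (InRS⇒⊆ AB∈RS a , ▽⊆ x∈F)))

proposition4p12 : {ℓ : Level} → ExcludedMiddle ℓ → (U : Set ℓ) (_≲_ : Rel U ℓ) → IsQuasiorder _≲_ →
    ∀ a b → Approx.InRS _≲_ a → Approx.InRS _≲_ b →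
    Approx.IsRelPseudocomplement _≲_ a b (Approx.rpcFormula _≲_ a b)
proposition4p12 em U _≲_ qo a b a∈RS b∈RS =
    rpcFormula-InRS qo em a b a∈RS b∈RS
  , rpcFormula-meet qo a b
  , λ z z∈RS → rpcFormula-greatest qo em a b z z∈RS
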